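{- Let $d,k$ be integers with $d,k\ge 2$. Then every edge-coloring of $K_n$ with $k$ colors, where $n\ge d^{12k}$, that contains no rainbow $K_d$ contains a monochromatic $K_4$. In particular, $g(k,d)<d^{12k}$.
   Context: A copy of $K_t$ is rainbow if all of its $\binom{t}{2}$ edges receive distinct colors, and monochromatic if all its edges receive the same color. For positive integers $k,t$, $g(k,t)$ denotes the largest positive integer $n$ such that there is an edge-coloring of $K_n$ with $k$ colors containing no rainbow $K_t$ and in which the edges of every copy of $K_4$ receive at least three distinct colors. -}

module Defs where

open import Data.Nat using (ℕ)
open import Data.Fin using (Fin)
open import Data.Product using (Σ; _×_; _,_)
open import Data.Sum using (_⊎_)
open import Relation.Binary.PropositionalEquality using (_≡_; _≢_)
open import Relation.Nullary using (¬_)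
open import Function.Definitions using (Injective)

-- An edge-coloring of K_n with k colors: a symmetric function on pairs of
-- vertices; the values on the diagonal (non-edges) are irrelevant.
record EdgeColoring (n k : ℕ) : Set where
  field
    col : Fin n → Fin n → Fin k
    sym : ∀ u v → col u v ≡ col v u
open EdgeColoring public

Copy : ℕ → ℕ → Set
Copy t n = Σ (Fin t → Fin n) (Injective _≡_ _≡_)

SameEdge : ∀ {t} → Fin t → Fin t → Fin t → Fin t → Set
SameEdge i j i' j' = (i ≡ i' × j ≡ j') ⊎ (i ≡ j' × j ≡ i')

Rainbow : ∀ {n k t} → EdgeColoring n k → Copy t n → Set
Rainbow c (f , _) = ∀ i j i' j' → i ≢ j → i' ≢ j' → ¬ SameEdge i j i' j' →
  col c (f i) (f j) ≢ col c (f i') (f j')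

Monochromatic : ∀ {n k t} → EdgeColoring n k → Copy t n → Set
Monochromatic c (f , _) = ∀ i j i' j' → i ≢ j → i' ≢ j' →
  col c (f i) (f j) ≡ col c (f i') (f j')

HasRainbow : ∀ {n k} → ℕ → EdgeColoring n k → Set
HasRainbow t c = Σ (Copy t _) (Rainbow c)

HasMonochromatic : ∀ {n k} → ℕ → EdgeColoring n k → Set
HasMonochromatic t c = Σ (Copy t _) (Monochromatic c)

module Submission where

-- Write D = d⁴ and call a vertex set V sparse if every vertex of V has at most |V|/D
-- neighbours in V of any single colour.  In a sparse set with at least d⁸ vertices a rainbow
-- K_d is built greedily: alongside the current rainbow clique keep the set W of vertices that
-- extend it.  Adding a vertex u ∈ W loses only the vertices of W that conflict with u; all
-- kinds of conflict but one are confined to few monochromatic neighbourhoods, and the remaining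
-- kind is small for some u ∈ W by averaging, so W loses O(d²|V|/D) vertices per step.
-- Hence, with no rainbow K_d, every set with at least d⁸ vertices contains a vertex v and a
-- colour γ whose γ-neighbourhood has at least |V|/D vertices; passing to it makes v a hub of
-- colour γ, joined in colour γ to all vertices that remain.  Since n ≥ d^(12k) ≥ D^(2k) d⁸,
-- this can go on until some colour has three hubs, which form a monochromatic K₄ with any
-- remaining vertex.

open import Data.Nat
open import Data.Nat.Properties
open import Data.Nat.Solver using (module +-*-Solver)
open import Data.Bool using (Bool; true; false; T)
open import Data.Fin using (Fin; zero; suc)
open import Data.Fin.Patterns using (0F; 1F; 2F; 3F; 4F)
import Data.Fin.Properties as Fin
open import Data.Product using (Σ; ∃; ∃₂; _×_; _,_; proj₁; proj₂)
open import Data.Sum using (_⊎_; inj₁; inj₂; [_,_]′)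
open import Function using (_∘_)
open import Relation.Nullary using (¬_; Dec; yes; no; contradiction)
open import Relation.Nullary.Decidable using (isYes; T?; ¬?; _×-dec_; _⊎-dec_; toWitness; fromWitness)
open import Relation.Binary.PropositionalEquality hiding (sym)
import Relation.Binary.PropositionalEquality as ≡
open import Defs
open import Data.Vec.Functional using (_∷_; [])
open import Function.Definitions using (Injective)
open import Algebra.Properties.Semiring.Sum +-*-semiring
  using (sum; sum-syntax; sum-cong-≗; ∑-distrib-+; ∑-comm; *-distribˡ-sum; *-distribʳ-sum)

private variable
  n : ℕ

term≤sum : ∀ (f : Fin n → ℕ) x → f x ≤ sum f
term≤sum f zero = m≤m+n _ _
term≤sum f (suc x) = ≤-trans (term≤sum (f ∘ suc) x) (m≤n+m _ _)

sum-mono-≤ : ∀ {f g : Fin n → ℕ} → (∀ x → f x ≤ g x) → sum f ≤ sum g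
sum-mono-≤ {zero} f≤g = z≤n
sum-mono-≤ {suc n} f≤g = +-mono-≤ (f≤g zero) (sum-mono-≤ (f≤g ∘ suc))

sum-mono-< : ∀ {f g : Fin n → ℕ} → (∀ x → f x ≤ g x) → ∀ x → f x < g x → sum f < sum g
sum-mono-< f≤g zero fx<gx = +-mono-<-≤ fx<gx (sum-mono-≤ (f≤g ∘ suc))
sum-mono-< f≤g (suc x) fx<gx = +-mono-≤-< (f≤g zero) (sum-mono-< (f≤g ∘ suc) x fx<gx)

sum-const : ∀ n a → ∑[ x < n ] a ≡ n * a
sum-const zero a = refl
sum-const (suc n) a = cong (a +_) (sum-const n a)

sum-suc-at : ∀ {f g : Fin n → ℕ} x₀ → (∀ x → x ≢ x₀ → f x ≡ g x) → f x₀ ≡ suc (g x₀) →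
             sum f ≡ suc (sum g)
sum-suc-at {suc n} zero f≡g fx₀ = cong₂ _+_ fx₀ (sum-cong-≗ λ x → f≡g (suc x) λ ())
sum-suc-at {suc n} {f} {g} (suc x₀) f≡g fx₀ = begin
  f zero + sum (f ∘ suc)        ≡⟨ cong₂ _+_ (f≡g zero λ ()) (sum-suc-at x₀ f≡g∘suc fx₀) ⟩
  g zero + suc (sum (g ∘ suc))  ≡⟨ +-suc (g zero) _ ⟩
  suc (sum g)                   ∎
  where
  open ≡-Reasoning
  f≡g∘suc : ∀ x → x ≢ x₀ → f (suc x) ≡ g (suc x)
  f≡g∘suc x x≢x₀ = f≡g (suc x) (x≢x₀ ∘ Fin.suc-injective)

sum-family-≤ : ∀ D {j} (M : Fin j → ℕ) (g : Fin j → Fin n → ℕ) → (∀ a → D * sum (g a) ≤ M a) →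
               D * ∑[ x < n ] ∑[ a < j ] g a x ≤ sum M
sum-family-≤ {n} D {j} M g bound = begin
  D * ∑[ x < n ] ∑[ a < j ] g a x  ≡⟨ cong (D *_) (∑-comm (λ x a → g a x)) ⟩
  D * ∑[ a < j ] sum (g a)         ≡⟨ *-distribˡ-sum D (λ a → sum (g a)) ⟩
  ∑[ a < j ] (D * sum (g a))       ≤⟨ sum-mono-≤ bound ⟩
  sum M                            ∎
  where open ≤-Reasoning

sum-family-≤-const : ∀ D {j} M (g : Fin j → Fin n → ℕ) → (∀ a → D * sum (g a) ≤ M) →
                     D * ∑[ x < n ] ∑[ a < j ] g a x ≤ j * M
sum-family-≤-const D {j} M g bound =
  ≤-trans (sum-family-≤ D (λ _ → M) g bound) (≤-reflexive (sum-const j M))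

𝟙 : Bool → ℕ
𝟙 true = 1
𝟙 false = 0

𝟙-≤ : ∀ {b m} → (T b → 1 ≤ m) → 𝟙 b ≤ m
𝟙-≤ {true} 1≤m = 1≤m _
𝟙-≤ {false} _ = z≤n

¬T⇒𝟙≡0 : ∀ {b} → ¬ T b → 𝟙 b ≡ 0
¬T⇒𝟙≡0 {true} ¬b = contradiction _ ¬b
¬T⇒𝟙≡0 {false} _ = refl

T⇒𝟙≡1 : ∀ {b} → T b → 𝟙 b ≡ 1
T⇒𝟙≡1 {true} _ = refl

T⇒1≤𝟙 : ∀ {b} → T b → 1 ≤ 𝟙 b
T⇒1≤𝟙 {true} _ = ≤-refl

T⇒𝟙*≡ : ∀ {b} m → T b → 𝟙 b * m ≡ m
T⇒𝟙*≡ m b = trans (cong (_* m) (T⇒𝟙≡1 b)) (*-identityˡ m)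

𝟙*-≤ : ∀ {b m k} → (T b → m ≤ k) → 𝟙 b * m ≤ k
𝟙*-≤ {true} {m} m≤k = subst (_≤ _) (≡.sym (T⇒𝟙*≡ m _)) (m≤k _)
𝟙*-≤ {false} _ = z≤n

card : (Fin n → Bool) → ℕ
card {n} A = ∑[ x < n ] 𝟙 (A x)

card-singleton : ∀ (u : Fin n) → card (λ x → isYes (x Fin.≟ u)) ≡ 1
card-singleton {n} u = begin
  card (λ x → isYes (x Fin.≟ u))  ≡⟨ sum-suc-at u (λ x x≢u → ¬T⇒𝟙≡0 (x≢u ∘ toWitness))
                                                     (T⇒𝟙≡1 (fromWitness refl)) ⟩
  suc (∑[ x < n ] 0)               ≡⟨ cong suc (trans (sum-const n 0) (*-zeroʳ n)) ⟩
  1                                ∎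
  where open ≡-Reasoning

𝟙≤sum : ∀ {j} (S : Fin j → Bool) a → T (S a) → 1 ≤ ∑[ a < j ] 𝟙 (S a)
𝟙≤sum S a Sa = ≤-trans (T⇒1≤𝟙 Sa) (term≤sum (𝟙 ∘ S) a)

card-cover : ∀ {A B : Fin n → Bool} {g : Fin n → ℕ} →
             (∀ x → T (A x) → T (B x) ⊎ 1 ≤ g x) → card A ≤ card B + sum g
card-cover {n} {A} {B} {g} cover = begin
  card A                        ≤⟨ sum-mono-≤ (λ x → 𝟙-≤ ([ inB x , inG x ]′ ∘ cover x)) ⟩
  ∑[ x < n ] (𝟙 (B x) + g x)    ≡⟨ ∑-distrib-+ (𝟙 ∘ B) g ⟩
  card B + sum g                ∎
  where
  open ≤-Reasoning
  inB : ∀ x → T (B x) → 1 ≤ 𝟙 (B x) + g x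
  inB x Bx = ≤-trans (T⇒1≤𝟙 Bx) (m≤m+n _ _)
  inG : ∀ x → 1 ≤ g x → 1 ≤ 𝟙 (B x) + g x
  inG x 1≤g = ≤-trans 1≤g (m≤n+m _ _)

card-empty : ∀ {A : Fin n → Bool} → (∀ x → ¬ T (A x)) → card A ≡ 0
card-empty {n} empty = trans (sum-cong-≗ (λ x → ¬T⇒𝟙≡0 (empty x))) (trans (sum-const n 0) (*-zeroʳ n))

card-pos⇒nonempty : ∀ (A : Fin n → Bool) → 0 < card A → ∃ λ x → T (A x)
card-pos⇒nonempty A 0<card with Fin.any? (λ x → T? (A x))
... | yes nonempty = nonempty
... | no empty = contradiction (≡.sym (card-empty (λ x Ax → empty (x , Ax)))) (<⇒≢ 0<card)

below-average : ∀ (A : Fin n → Bool) (h : Fin n → ℕ) M → (∃ λ x → T (A x)) →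
                sum h ≤ card A * M → ∃ λ x → T (A x) × h x ≤ M
below-average {n} A h M (x₀ , Ax₀) sum≤ with Fin.any? (λ x → T? (A x) ×-dec h x ≤? M)
... | yes found = found
... | no none = contradiction sum≤ (<⇒≱ (begin-strict
  card A * M                  ≡⟨ *-distribʳ-sum M (𝟙 ∘ A) ⟩
  ∑[ x < n ] (𝟙 (A x) * M)    <⟨ sum-mono-< (λ x → 𝟙*-≤ (<⇒≤ ∘ above x)) x₀ M<hx₀ ⟩
  sum h                       ∎))
  where
  open ≤-Reasoning
  above : ∀ x → T (A x) → M < h x
  above x Ax = ≰⇒> (λ hx≤M → none (x , Ax , hx≤M))
  M<hx₀ : 𝟙 (A x₀) * M < h x₀
  M<hx₀ = subst (_< h x₀) (≡.sym (T⇒𝟙*≡ M Ax₀)) (above x₀ Ax₀)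

update : ∀ {P : Fin n → Set} x → P x → (∀ y → P y) → ∀ y → P y
update x p f y with y Fin.≟ x
... | yes refl = p
... | no _ = f y

update-≡ : ∀ {P : Fin n → Set} x p (f : ∀ y → P y) → update x p f x ≡ p
update-≡ x p f with x Fin.≟ x
... | yes refl = refl
... | no x≢x = contradiction refl x≢x

update-≢ : ∀ {P : Fin n → Set} {x y} p (f : ∀ y → P y) → y ≢ x → update x p f y ≡ f y
update-≢ {x = x} {y} p f y≢x with y Fin.≟ x
... | yes y≡x = contradiction y≡x y≢x
... | no _ = refl

-- D times the number of candidates lost, for each of the five kinds of Conflict below, when a
-- vertex joins a rainbow clique of size i inside a sparse set of m vertices.
budget : (D m i : ℕ) → Fin 5 → ℕ
budget D m i 0F = D
budget D m i 1F = i * m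
budget D m i 2F = i * (i * m)
budget D m i 3F = i * m
budget D m i 4F = i * (i * m)

budget-mono : ∀ D m {i j} → i ≤ j → ∀ r → budget D m i r ≤ budget D m j r
budget-mono D m i≤j 0F = ≤-refl
budget-mono D m i≤j 1F = *-monoˡ-≤ m i≤j
budget-mono D m i≤j 2F = *-mono-≤ i≤j (*-monoˡ-≤ m i≤j)
budget-mono D m i≤j 3F = *-monoˡ-≤ m i≤j
budget-mono D m i≤j 4F = *-mono-≤ i≤j (*-monoˡ-≤ m i≤j)

quartic-bound : ∀ {d} → 3 ≤ d → 1 + (2 * d ^ 2 + 2 * d ^ 3) ≤ d ^ 4
quartic-bound 3≤d with e , refl ← m≤n⇒∃[o]m+o≡n 3≤d =
  ≤-trans (m≤m+n _ _) (≤-reflexive (expand e))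
  where
  open +-*-Solver
  expand : ∀ e → 1 + (2 * (3 + e) ^ 2 + 2 * (3 + e) ^ 3) + (8 + 42 * e + 34 * e ^ 2 + 10 * e ^ 3 + e ^ 4)
                 ≡ (3 + e) ^ 4
  expand = solve 1 (λ e → con 1 :+ (con 2 :* (con 3 :+ e) :^ 2 :+ con 2 :* (con 3 :+ e) :^ 3)
                           :+ (con 8 :+ con 42 :* e :+ con 34 :* e :^ 2 :+ con 10 :* e :^ 3 :+ e :^ 4)
                          := (con 3 :+ e) :^ 4) refl

greedy-arithmetic : ∀ d m → 3 ≤ d → d ^ 8 ≤ m → d * ∑[ r < 5 ] budget (d ^ 4) m d r < d ^ 4 * m
greedy-arithmetic d m 3≤d d⁸≤m = begin-strict
  d * ∑[ r < 5 ] budget (d ^ 4) m d r  ≡⟨ expand d m ⟩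
  d ^ 5 + K * m                        <⟨ +-monoˡ-< (K * m) (<-≤-trans (^-monoʳ-< d 1<d 5<8) d⁸≤m) ⟩
  m + K * m                            ≤⟨ *-monoˡ-≤ m (quartic-bound 3≤d) ⟩
  d ^ 4 * m                            ∎
  where
  open ≤-Reasoning
  open +-*-Solver
  K : ℕ
  K = 2 * d ^ 2 + 2 * d ^ 3
  1<d : 1 < d
  1<d = ≤-trans (s≤s (s≤s z≤n)) 3≤d
  5<8 : 5 < 8
  5<8 = s≤s (s≤s (s≤s (s≤s (s≤s (s≤s z≤n)))))
  expand : ∀ d m → d * (d ^ 4 + (d * m + (d * (d * m) + (d * m + (d * (d * m) + 0))))) ≡
                   d ^ 5 + (2 * d ^ 2 + 2 * d ^ 3) * m
  expand = solve 2 (λ d m → d :* (d :^ 4 :+ (d :* m :+ (d :* (d :* m) :+ (d :* m :+ (d :* (d :* m) :+ con 0)))))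
                          := d :^ 5 :+ (con 2 :* d :^ 2 :+ con 2 :* d :^ 3) :* m) refl

module Coloring {n k : ℕ} (c : EdgeColoring n k) where

  χ : Fin n → Fin n → Fin k
  χ = col c

  χ-sym : ∀ u v → χ u v ≡ χ v u
  χ-sym = EdgeColoring.sym c

  ∷-injective : ∀ {j u} {f : Fin j → Fin n} → Injective _≡_ _≡_ f → (∀ a → f a ≢ u) →
                Injective _≡_ _≡_ (u ∷ f)
  ∷-injective inj fresh {zero}  {zero}  _ = refl
  ∷-injective inj fresh {zero}  {suc b} e = contradiction (≡.sym e) (fresh b)
  ∷-injective inj fresh {suc a} {zero}  e = contradiction e (fresh a)
  ∷-injective inj fresh {suc a} {suc b} e = cong suc (inj e)

  record RainbowClique (j : ℕ) : Set where
    field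
      vertex : Fin j → Fin n
      injective : Injective _≡_ _≡_ vertex
      rainbow : Rainbow c (vertex , injective)

  record Extends {j} (f : Fin j → Fin n) (w : Fin n) : Set where
    field
      fresh : ∀ a → f a ≢ w
      distinct : ∀ a b → a ≢ b → χ w (f a) ≢ χ w (f b)
      new : ∀ a a′ b′ → a′ ≢ b′ → χ w (f a) ≢ χ (f a′) (f b′)

  hasRainbow : ∀ {j} → RainbowClique j → HasRainbow j c
  hasRainbow K = (vertex , injective) , rainbow
    where open RainbowClique K

  empty-clique : RainbowClique 0
  empty-clique = record { vertex = [] ; injective = λ { {()} } ; rainbow = λ () }

  extends-[] : ∀ {w} → Extends [] w
  extends-[] = record { fresh = λ () ; distinct = λ () ; new = λ () }

  rainbow-∷ : ∀ {j w} (K : RainbowClique j) → Extends (RainbowClique.vertex K) w → RainbowClique (suc j)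
  rainbow-∷ {j} {w} K ext = record
    { vertex = w ∷ f ; injective = ∷-injective injective fresh ; rainbow = rb }
    where
    open RainbowClique K renaming (vertex to f)
    open Extends ext
    suc-≢ : ∀ {a b : Fin j} → suc a ≢ suc b → a ≢ b
    suc-≢ ne = ne ∘ cong suc
    rb : Rainbow c (w ∷ f , ∷-injective injective fresh)
    rb zero zero _ _ ne _ _ = contradiction refl ne
    rb _ _ zero zero _ ne _ = contradiction refl ne
    rb zero (suc b) zero (suc b′) _ _ ¬same = distinct b b′ (λ { refl → ¬same (inj₁ (refl , refl)) })
    rb zero (suc b) (suc a′) zero _ _ ¬same eq =
      distinct b a′ (λ { refl → ¬same (inj₂ (refl , refl)) }) (trans eq (χ-sym (f a′) w))
    rb zero (suc b) (suc a′) (suc b′) _ ne′ _ = new b a′ b′ (suc-≢ ne′)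
    rb (suc a) zero zero (suc b′) _ _ ¬same eq =
      distinct a b′ (λ { refl → ¬same (inj₂ (refl , refl)) }) (trans (χ-sym w (f a)) eq)
    rb (suc a) zero (suc a′) zero _ _ ¬same eq =
      distinct a a′ (λ { refl → ¬same (inj₁ (refl , refl)) })
        (trans (χ-sym w (f a)) (trans eq (χ-sym (f a′) w)))
    rb (suc a) zero (suc a′) (suc b′) _ ne′ _ eq = new a a′ b′ (suc-≢ ne′) (trans (χ-sym w (f a)) eq)
    rb (suc a) (suc b) zero (suc b′) ne _ _ eq = new b′ a b (suc-≢ ne) (≡.sym eq)
    rb (suc a) (suc b) (suc a′) zero ne _ _ eq = new a′ a b (suc-≢ ne) (≡.sym (trans eq (χ-sym (f a′) w)))
    rb (suc a) (suc b) (suc a′) (suc b′) ne ne′ ¬same =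
      rainbow a b a′ b′ (suc-≢ ne) (suc-≢ ne′) (¬same ∘ suc-same)
      where
      suc-same : SameEdge a b a′ b′ → SameEdge (suc a) (suc b) (suc a′) (suc b′)
      suc-same (inj₁ (refl , refl)) = inj₁ (refl , refl)
      suc-same (inj₂ (refl , refl)) = inj₂ (refl , refl)

  rainbow-K₂ : ∀ {u v} → u ≢ v → HasRainbow 2 c
  rainbow-K₂ {u} {v} u≢v = hasRainbow (rainbow-∷ (rainbow-∷ empty-clique extends-[]) u-extends)
    where
    u-extends : Extends (u ∷ []) v
    u-extends = record
      { fresh = λ { zero → u≢v }
      ; distinct = λ { zero zero ne → contradiction refl ne }
      ; new = λ { _ zero zero ne → contradiction refl ne }
      }

  Conflict : ∀ {j} → (Fin j → Fin n) → Fin n → Fin n → Set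
  Conflict f u w = w ≡ u
                 ⊎ (∃ λ a → χ w u ≡ χ w (f a))
                 ⊎ (∃₂ λ a b → χ w u ≡ χ (f a) (f b))
                 ⊎ (∃ λ a → χ w u ≡ χ u (f a))
                 ⊎ (∃₂ λ a a′ → χ w (f a) ≡ χ u (f a′))

  conflict? : ∀ {j} (f : Fin j → Fin n) u w → Dec (Conflict f u w)
  conflict? f u w = w Fin.≟ u
                  ⊎-dec Fin.any? (λ a → χ w u Fin.≟ χ w (f a))
                  ⊎-dec Fin.any? (λ a → Fin.any? λ b → χ w u Fin.≟ χ (f a) (f b))
                  ⊎-dec Fin.any? (λ a → χ w u Fin.≟ χ u (f a))
                  ⊎-dec Fin.any? (λ a → Fin.any? λ a′ → χ w (f a) Fin.≟ χ u (f a′))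

  extends-∷ : ∀ {j u w} {f : Fin j → Fin n} → Extends f w → ¬ Conflict f u w → Extends (u ∷ f) w
  extends-∷ {j} {u} {w} {f} ext ¬conflict = record { fresh = fresh′ ; distinct = distinct′ ; new = new′ }
    where
    open Extends ext
    fresh′ : ∀ a → (u ∷ f) a ≢ w
    fresh′ zero u≡w = ¬conflict (inj₁ (≡.sym u≡w))
    fresh′ (suc a) = fresh a
    no-clash : ∀ a → χ w u ≢ χ w (f a)
    no-clash a eq = ¬conflict (inj₂ (inj₁ (a , eq)))
    distinct′ : ∀ a b → a ≢ b → χ w ((u ∷ f) a) ≢ χ w ((u ∷ f) b)
    distinct′ zero zero ne = contradiction refl ne
    distinct′ zero (suc b) _ = no-clash b
    distinct′ (suc a) zero _ = no-clash a ∘ ≡.sym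
    distinct′ (suc a) (suc b) ne = distinct a b (ne ∘ cong suc)
    new′ : ∀ a a′ b′ → a′ ≢ b′ → χ w ((u ∷ f) a) ≢ χ ((u ∷ f) a′) ((u ∷ f) b′)
    new′ _ zero zero ne = contradiction refl ne
    new′ zero zero (suc b′) _ eq = ¬conflict (inj₂ (inj₂ (inj₂ (inj₁ (b′ , eq)))))
    new′ zero (suc a′) zero _ eq =
      ¬conflict (inj₂ (inj₂ (inj₂ (inj₁ (a′ , trans eq (χ-sym (f a′) u))))))
    new′ zero (suc a′) (suc b′) _ eq = ¬conflict (inj₂ (inj₂ (inj₁ (a′ , b′ , eq))))
    new′ (suc a) zero (suc b′) _ eq = ¬conflict (inj₂ (inj₂ (inj₂ (inj₂ (a , b′ , eq)))))
    new′ (suc a) (suc a′) zero _ eq =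
      ¬conflict (inj₂ (inj₂ (inj₂ (inj₂ (a , a′ , trans eq (χ-sym (f a′) u))))))
    new′ (suc a) (suc a′) (suc b′) ne = new a a′ b′ (ne ∘ cong suc)

  N : (Fin n → Bool) → Fin n → Fin k → Fin n → Bool
  N V v γ y = isYes (T? (V y) ×-dec ¬? (y Fin.≟ v) ×-dec χ v y Fin.≟ γ)

  N⊆ : ∀ {V v γ y} → T (N V v γ y) → T (V y)
  N⊆ y∈N = proj₁ (toWitness y∈N)

  Sparse : ℕ → (Fin n → Bool) → Set
  Sparse D V = ∀ v γ → T (V v) → D * card (N V v γ) ≤ card V

  sparse⊎dense : ∀ D V → Sparse D V ⊎ ∃₂ λ v γ → T (V v) × card V < D * card (N V v γ)
  sparse⊎dense D V with Fin.any? (λ v → Fin.any? λ γ → T? (V v) ×-dec card V <? D * card (N V v γ))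
  ... | yes (v , γ , dense) = inj₂ (v , γ , dense)
  ... | no ¬dense = inj₁ λ v γ Vv → ≮⇒≥ (λ lt → ¬dense (v , γ , Vv , lt))

  module Greedy (d D : ℕ) (V : Fin n → Bool) (sparse : Sparse D V) where

    m : ℕ
    m = card V

    E : ℕ
    E = ∑[ r < 5 ] budget D m d r

    record State (i : ℕ) : Set where
      field
        clique : RainbowClique i
        clique⊆V : ∀ a → T (V (RainbowClique.vertex clique a))
        W : Fin n → Bool
        W⊆V : ∀ w → T (W w) → T (V w)
        extendable : ∀ w → T (W w) → Extends (RainbowClique.vertex clique) w
        large : D * m ≤ D * card W + i * E

    initial : State 0
    initial = record
      { clique = empty-clique
      ; clique⊆V = λ ()
      ; W = V
      ; W⊆V = λ _ Vw → Vw
      ; extendable = λ _ _ → extends-[]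
      ; large = m≤m+n _ _
      }

    module Step {i} (st : State i) where
      open State st
      open RainbowClique clique using () renaming (vertex to f)

      clash : Fin n → Fin n → Bool
      clash u w = isYes (T? (W u) ×-dec T? (W w) ×-dec ¬? (w Fin.≟ u)
                         ×-dec Fin.any? (λ a → χ w u Fin.≟ χ w (f a)))

      clash-row : ∀ w → D * ∑[ u < n ] 𝟙 (clash u w) ≤ 𝟙 (W w) * (i * m)
      clash-row w = row (T? (W w))
        where
        open ≤-Reasoning
        in-N : ∀ u → T (clash u w) → 1 ≤ ∑[ a < i ] 𝟙 (N V w (χ w (f a)) u)
        in-N u clash-uw with Wu , _ , w≢u , a , eq ← toWitness clash-uw =
          𝟙≤sum (λ a → N V w (χ w (f a)) u) a (fromWitness (W⊆V u Wu , w≢u ∘ ≡.sym , eq))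
        row : Dec (T (W w)) → D * ∑[ u < n ] 𝟙 (clash u w) ≤ 𝟙 (W w) * (i * m)
        row (no w∉W) = begin
          D * ∑[ u < n ] 𝟙 (clash u w)  ≡⟨ cong (D *_) (card-empty {A = λ u → clash u w} λ u clash-uw →
                                                        w∉W (proj₁ (proj₂ (toWitness clash-uw)))) ⟩
          D * 0                         ≡⟨ *-zeroʳ D ⟩
          0                             ≤⟨ z≤n ⟩
          𝟙 (W w) * (i * m)             ∎
        row (yes Ww) = begin
          D * ∑[ u < n ] 𝟙 (clash u w)
            ≤⟨ *-monoʳ-≤ D (sum-mono-≤ λ u → 𝟙-≤ (in-N u)) ⟩
          D * ∑[ u < n ] ∑[ a < i ] 𝟙 (N V w (χ w (f a)) u)
            ≤⟨ sum-family-≤-const D m (λ a u → 𝟙 (N V w (χ w (f a)) u)) (λ a → sparse w _ (W⊆V w Ww)) ⟩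
          i * m
            ≡⟨ ≡.sym (T⇒𝟙*≡ (i * m) Ww) ⟩
          𝟙 (W w) * (i * m)                                  ∎

      clashes-total : ∑[ u < n ] (D * card (clash u)) ≤ card W * (i * m)
      clashes-total = begin
        ∑[ u < n ] (D * card (clash u))            ≡⟨ ≡.sym (*-distribˡ-sum D (card ∘ clash)) ⟩
        D * ∑[ u < n ] ∑[ w < n ] 𝟙 (clash u w)    ≡⟨ cong (D *_) (∑-comm (λ u w → 𝟙 (clash u w))) ⟩
        D * ∑[ w < n ] ∑[ u < n ] 𝟙 (clash u w)    ≡⟨ *-distribˡ-sum D (λ w → ∑[ u < n ] 𝟙 (clash u w)) ⟩
        ∑[ w < n ] (D * ∑[ u < n ] 𝟙 (clash u w))  ≤⟨ sum-mono-≤ clash-row ⟩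
        ∑[ w < n ] (𝟙 (W w) * (i * m))             ≡⟨ ≡.sym (*-distribʳ-sum (i * m) (𝟙 ∘ W)) ⟩
        card W * (i * m)                           ∎
        where open ≤-Reasoning

      W-nonempty : i * E < D * m → ∃ λ w → T (W w)
      W-nonempty iE<Dm = card-pos⇒nonempty W (n≢0⇒n>0 λ card≡0 → <⇒≱ iE<Dm (begin
        D * m               ≤⟨ large ⟩
        D * card W + i * E  ≡⟨ cong (λ x → D * x + i * E) card≡0 ⟩
        D * 0 + i * E       ≡⟨ cong (_+ i * E) (*-zeroʳ D) ⟩
        i * E               ∎))
        where open ≤-Reasoning

      -- Sparseness bounds the clashes of a single u only on average over u ∈ W.
      fewest-clashes : i * E < D * m → ∃ λ u → T (W u) × D * card (clash u) ≤ i * m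
      fewest-clashes iE<Dm = below-average W (λ u → D * card (clash u)) (i * m) (W-nonempty iE<Dm) clashes-total

      module Extend (i≤d : i ≤ d) (u : Fin n) (Wu : T (W u)) (few : D * card (clash u) ≤ i * m) where

        W′ : Fin n → Bool
        W′ w = isYes (T? (W w) ×-dec ¬? (conflict? f u w))

        Vu : T (V u)
        Vu = W⊆V u Wu

        cost : Fin 5 → Fin n → ℕ
        cost 0F w = 𝟙 (isYes (w Fin.≟ u))
        cost 1F w = 𝟙 (clash u w)
        cost 2F w = ∑[ a < i ] ∑[ b < i ] 𝟙 (N V u (χ (f a) (f b)) w)
        cost 3F w = ∑[ a < i ] 𝟙 (N V u (χ u (f a)) w)
        cost 4F w = ∑[ a < i ] ∑[ a′ < i ] 𝟙 (N V (f a) (χ u (f a′)) w)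

        cost-bound : ∀ r → D * sum (cost r) ≤ budget D m i r
        cost-bound 0F = ≤-reflexive (trans (cong (D *_) (card-singleton u)) (*-identityʳ D))
        cost-bound 1F = few
        cost-bound 2F =
          sum-family-≤-const D (i * m) (λ a w → ∑[ b < i ] 𝟙 (N V u (χ (f a) (f b)) w)) λ a →
          sum-family-≤-const D m (λ b w → 𝟙 (N V u (χ (f a) (f b)) w)) λ b → sparse u _ Vu
        cost-bound 3F =
          sum-family-≤-const D m (λ a w → 𝟙 (N V u (χ u (f a)) w)) λ a → sparse u _ Vu
        cost-bound 4F =
          sum-family-≤-const D (i * m) (λ a w → ∑[ a′ < i ] 𝟙 (N V (f a) (χ u (f a′)) w)) λ a →
          sum-family-≤-const D m (λ a′ w → 𝟙 (N V (f a) (χ u (f a′)) w)) λ a′ →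
          sparse (f a) _ (clique⊆V a)

        conflict-cost : ∀ w → T (W w) → Conflict f u w → ∃ λ r → 1 ≤ cost r w
        conflict-cost w Ww conflict with w Fin.≟ u
        ... | yes w≡u = 0F , T⇒1≤𝟙 (fromWitness w≡u)
        ... | no w≢u with conflict
        ...   | inj₁ w≡u = contradiction w≡u w≢u
        ...   | inj₂ (inj₁ (a , eq)) =
          1F , T⇒1≤𝟙 (fromWitness (Wu , Ww , w≢u , a , eq))
        ...   | inj₂ (inj₂ (inj₁ (a , b , eq))) =
          2F , ≤-trans (𝟙≤sum _ b (fromWitness (W⊆V w Ww , w≢u , trans (χ-sym u w) eq))) (term≤sum _ a)
        ...   | inj₂ (inj₂ (inj₂ (inj₁ (a , eq)))) =
          3F , 𝟙≤sum _ a (fromWitness (W⊆V w Ww , w≢u , trans (χ-sym u w) eq))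
        ...   | inj₂ (inj₂ (inj₂ (inj₂ (a , a′ , eq)))) =
          4F , ≤-trans (𝟙≤sum _ a′ (fromWitness (W⊆V w Ww , Extends.fresh (extendable w Ww) a ∘ ≡.sym ,
                                                  trans (χ-sym (f a) w) eq)))
                       (term≤sum _ a)

        loss : Fin n → ℕ
        loss w = ∑[ r < 5 ] cost r w

        loss-bound : D * sum loss ≤ E
        loss-bound = begin
          D * ∑[ w < n ] ∑[ r < 5 ] cost r w  ≤⟨ sum-family-≤ D (budget D m i) cost cost-bound ⟩
          ∑[ r < 5 ] budget D m i r           ≤⟨ sum-mono-≤ (budget-mono D m i≤d) ⟩
          E                                   ∎
          where open ≤-Reasoning

        W-shrinks : card W ≤ card W′ + sum loss
        W-shrinks = card-cover (λ w Ww → cover w Ww (conflict? f u w))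
          where
          cover : ∀ w → T (W w) → Dec (Conflict f u w) → T (W′ w) ⊎ 1 ≤ loss w
          cover w Ww (yes conflict) with conflict-cost w Ww conflict
          ... | r , 1≤cost = inj₂ (≤-trans 1≤cost (term≤sum (λ r → cost r w) r))
          cover w Ww (no ¬conflict) = inj₁ (fromWitness (Ww , ¬conflict))

        large′ : D * m ≤ D * card W′ + suc i * E
        large′ = begin
          D * m                                ≤⟨ large ⟩
          D * card W + i * E                   ≤⟨ +-monoˡ-≤ (i * E) (*-monoʳ-≤ D W-shrinks) ⟩
          D * (card W′ + sum loss) + i * E     ≡⟨ cong (_+ i * E) (*-distribˡ-+ D (card W′) (sum loss)) ⟩
          D * card W′ + D * sum loss + i * E   ≤⟨ +-monoˡ-≤ (i * E) (+-monoʳ-≤ (D * card W′) loss-bound) ⟩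
          D * card W′ + E + i * E              ≡⟨ +-assoc (D * card W′) E (i * E) ⟩
          D * card W′ + suc i * E              ∎
          where open ≤-Reasoning

        next : State (suc i)
        next = record
          { clique = rainbow-∷ clique (extendable u Wu)
          ; clique⊆V = λ { 0F → Vu ; (suc a) → clique⊆V a }
          ; W = W′
          ; W⊆V = λ w w∈W′ → W⊆V w (proj₁ (toWitness w∈W′))
          ; extendable = λ w w∈W′ → let Ww , ¬conflict = toWitness w∈W′ in
                                     extends-∷ (extendable w Ww) ¬conflict
          ; large = large′
          }

    extend : ∀ {i} → i < d → d * E < D * m → State i → State (suc i)
    extend {i} i<d dE<Dm st
      with u , Wu , few ← Step.fewest-clashes st (≤-<-trans (*-monoˡ-≤ E (<⇒≤ i<d)) dE<Dm) =
      Step.Extend.next st (<⇒≤ i<d) u Wu few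

    build : d * E < D * m → ∀ i → i ≤ d → State i
    build _ zero _ = initial
    build dE<Dm (suc i) i<d = extend i<d dE<Dm (build dE<Dm i (<⇒≤ i<d))

    rainbow : d * E < D * m → HasRainbow d c
    rainbow dE<Dm = hasRainbow (State.clique (build dE<Dm d ≤-refl))

  EdgesColoured : ∀ {j} → Fin k → (Fin j → Fin n) → Set
  EdgesColoured γ f = ∀ a b → a ≢ b → χ (f a) (f b) ≡ γ

  ∷-edgesColoured : ∀ {j γ u} {f : Fin j → Fin n} → EdgesColoured γ f → (∀ a → χ u (f a) ≡ γ) →
                    EdgesColoured γ (u ∷ f)
  ∷-edgesColoured coloured u-f zero zero ne = contradiction refl ne
  ∷-edgesColoured coloured u-f zero (suc b) _ = u-f b
  ∷-edgesColoured {u = u} {f} coloured u-f (suc a) zero _ = trans (χ-sym (f a) u) (u-f a)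
  ∷-edgesColoured coloured u-f (suc a) (suc b) ne = coloured a b (ne ∘ cong suc)

  Dominates : (Fin n → Bool) → Fin n → Fin k → Set
  Dominates V p γ = ∀ y → T (V y) → p ≢ y × χ p y ≡ γ

  N-dominated : ∀ V v γ → Dominates (N V v γ) v γ
  N-dominated V v γ y y∈N with toWitness y∈N
  ... | _ , y≢v , χvy≡γ = y≢v ∘ ≡.sym , χvy≡γ

  record HubClique (V : Fin n → Bool) (γ : Fin k) : Set where
    field
      size : ℕ
      hub : Fin size → Fin n
      injective : Injective _≡_ _≡_ hub
      coloured : EdgesColoured γ hub
      dominates : ∀ a → Dominates V (hub a) γ
  open HubClique

  no-hubs : ∀ {V γ} → HubClique V γ
  no-hubs = record { size = 0 ; hub = [] ; injective = λ { {()} } ; coloured = λ () ; dominates = λ () }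

  restrict : ∀ {V V′ γ} → (∀ y → T (V′ y) → T (V y)) → HubClique V γ → HubClique V′ γ
  restrict V′⊆V H = record
    { size = size H
    ; hub = hub H
    ; injective = injective H
    ; coloured = coloured H
    ; dominates = λ a y V′y → dominates H a y (V′⊆V y V′y)
    }

  add-hub : ∀ {V V′ γ v} → T (V v) → Dominates V′ v γ → (∀ y → T (V′ y) → T (V y)) →
            HubClique V γ → HubClique V′ γ
  add-hub {v = v} Vv v-dominates V′⊆V H = record
    { size = suc (size H)
    ; hub = v ∷ hub H
    ; injective = ∷-injective (injective H) (λ a → proj₁ (dominates H a v Vv))
    ; coloured = ∷-edgesColoured (coloured H) (λ a → trans (χ-sym v (hub H a)) (proj₂ (dominates H a v Vv)))
    ; dominates = λ { zero → v-dominates ; (suc a) → dominates (restrict V′⊆V H) a }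
    }

  close : ∀ {V γ x} → T (V x) → (H : HubClique V γ) → HasMonochromatic (suc (size H)) c
  close {x = x} Vx H = (x ∷ hub H , ∷-injective (injective H) (λ a → proj₁ (dominates H a x Vx))) ,
                       λ a b a′ b′ ne ne′ → trans (x-coloured a b ne) (≡.sym (x-coloured a′ b′ ne′))
    where
    x-coloured : EdgesColoured _ (x ∷ hub H)
    x-coloured = ∷-edgesColoured (coloured H) (λ a → trans (χ-sym x (hub H a)) (proj₂ (dominates H a x Vx)))

  module HubSearch (d : ℕ) (3≤d : 3 ≤ d) (no-rainbow : ¬ HasRainbow d c) where

    D : ℕ
    D = d ^ 4

    instance
      D-nonZero : NonZero D
      D-nonZero = m^n≢0 d 4 ⦃ >-nonZero (≤-trans (s≤s z≤n) 3≤d) ⦄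

    sparse⇒rainbow : ∀ {V} → d ^ 8 ≤ card V → Sparse D V → HasRainbow d c
    sparse⇒rainbow {V} large sparse =
      Greedy.rainbow d D V sparse (greedy-arithmetic d (card V) 3≤d large)

    vacancies : ∀ {V} → (∀ γ → HubClique V γ) → ℕ
    vacancies hubs = ∑[ γ < k ] (2 ∸ size (hubs γ))

    record State : Set where
      field
        V : Fin n → Bool
        hubs : ∀ γ → HubClique V γ
        at-most-two : ∀ γ → size (hubs γ) ≤ 2
        large : D ^ vacancies hubs * d ^ 8 ≤ card V
    open State

    module Grow (st : State) (v : Fin n) (γ : Fin k) (Vv : T (V st v))
                (dense : card (V st) < D * card (N (V st) v γ)) where

      V′ : Fin n → Bool
      V′ = N (V st) v γ

      V′⊆V : ∀ y → T (V′ y) → T (V st y)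
      V′⊆V _ = N⊆ {V st} {v} {γ}

      H : HubClique V′ γ
      H = add-hub Vv (N-dominated (V st) v γ) V′⊆V (hubs st γ)

      V′-nonempty : ∃ λ x → T (V′ x)
      V′-nonempty = card-pos⇒nonempty V′ (n≢0⇒n>0 λ card≡0 →
        n≮0 (subst (card (V st) <_) (trans (cong (D *_) card≡0) (*-zeroʳ D)) dense))

      restricted : ∀ γ′ → HubClique V′ γ′
      restricted γ′ = restrict V′⊆V (hubs st γ′)

      hubs′ : ∀ γ′ → HubClique V′ γ′
      hubs′ = update γ H restricted

      module _ (s<2 : size (hubs st γ) < 2) where

        vacancies-drop : vacancies (hubs st) ≡ suc (vacancies hubs′)
        vacancies-drop = sum-suc-at γ
          (λ γ′ γ′≢γ → cong (λ H → 2 ∸ size H) (≡.sym (update-≢ H restricted γ′≢γ)))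
          (trans (+-∸-assoc 1 (≤-pred s<2))
                 (cong (λ H → suc (2 ∸ size H)) (≡.sym (update-≡ γ H restricted))))

        at-most-two′ : ∀ γ′ → size (hubs′ γ′) ≤ 2
        at-most-two′ γ′ = bound (γ′ Fin.≟ γ)
          where
          bound : Dec (γ′ ≡ γ) → size (hubs′ γ′) ≤ 2
          bound (yes refl) = subst (λ H → size H ≤ 2) (≡.sym (update-≡ γ H restricted)) s<2
          bound (no γ′≢γ) =
            subst (λ H → size H ≤ 2) (≡.sym (update-≢ H restricted γ′≢γ)) (at-most-two st γ′)

        large′ : D ^ vacancies hubs′ * d ^ 8 ≤ card V′
        large′ = *-cancelˡ-≤ D (begin
          D * (D ^ vacancies hubs′ * d ^ 8)  ≡⟨ ≡.sym (*-assoc D _ _) ⟩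
          D ^ suc (vacancies hubs′) * d ^ 8  ≡⟨ cong (λ e → D ^ e * d ^ 8) (≡.sym vacancies-drop) ⟩
          D ^ vacancies (hubs st) * d ^ 8    ≤⟨ large st ⟩
          card (V st)                        ≤⟨ <⇒≤ dense ⟩
          D * card V′                        ∎)
          where open ≤-Reasoning

        next : State
        next = record { V = V′ ; hubs = hubs′ ; at-most-two = at-most-two′ ; large = large′ }

      grow : HasMonochromatic 4 c ⊎ Σ State λ st′ → vacancies (hubs st′) < vacancies (hubs st)
      grow with size (hubs st γ) ≟ 2
      ... | yes s≡2 = inj₁ (subst (λ t → HasMonochromatic t c) (cong (2 +_) s≡2)
                                  (close (proj₂ V′-nonempty) H))
      ... | no s≢2 = inj₂ (next s<2 , ≤-reflexive (≡.sym (vacancies-drop s<2)))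
        where
        s<2 : size (hubs st γ) < 2
        s<2 = ≤∧≢⇒< (at-most-two st γ) s≢2

    V-large : (st : State) → d ^ 8 ≤ card (V st)
    V-large st = ≤-trans (m≤n*m (d ^ 8) (D ^ vac) ⦃ m^n≢0 D vac ⦄) (large st)
      where
      vac : ℕ
      vac = vacancies (hubs st)

    step : (st : State) → HasMonochromatic 4 c ⊎ Σ State λ st′ → vacancies (hubs st′) < vacancies (hubs st)
    step st with sparse⊎dense D (V st)
    ... | inj₁ sparse = contradiction (sparse⇒rainbow (V-large st) sparse) no-rainbow
    ... | inj₂ (v , γ , Vv , dense) = Grow.grow st v γ Vv dense

    run : ∀ fuel (st : State) → vacancies (hubs st) ≤ fuel → HasMonochromatic 4 c
    run fuel st vac≤fuel with step st
    ... | inj₁ mono = mono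
    run zero st vac≤0 | inj₂ (st′ , shrinks) = contradiction (≤-trans shrinks vac≤0) λ ()
    run (suc fuel) st vac≤fuel | inj₂ (st′ , shrinks) = run fuel st′ (≤-pred (≤-trans shrinks vac≤fuel))

    monochromatic-K₄ : D ^ (k * 2) * d ^ 8 ≤ n → HasMonochromatic 4 c
    monochromatic-K₄ large = run (k * 2) initial (≤-reflexive (sum-const k 2))
      where
      initial : State
      initial = record
        { V = λ _ → true
        ; hubs = λ _ → no-hubs
        ; at-most-two = λ _ → z≤n
        ; large = subst (λ e → D ^ e * d ^ 8 ≤ card {n} (λ _ → true)) (≡.sym (sum-const k 2))
                        (≤-trans large (≤-reflexive (≡.sym (trans (sum-const n 1) (*-identityʳ n)))))
        }

two-distinct : ∀ {n} → 2 ≤ n → ∃₂ λ (u v : Fin n) → u ≢ v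
two-distinct {suc (suc n)} _ = zero , suc zero , λ ()
two-distinct {suc zero} (s≤s ())

exponent-bound : ∀ {d k} .⦃ _ : NonZero d ⦄ → 2 ≤ k → (d ^ 4) ^ (k * 2) * d ^ 8 ≤ d ^ (12 * k)
exponent-bound {d} {k} 2≤k with j , refl ← m≤n⇒∃[o]m+o≡n 2≤k = begin
  (d ^ 4) ^ ((2 + j) * 2) * d ^ 8  ≡⟨ cong (_* d ^ 8) (^-*-assoc d 4 ((2 + j) * 2)) ⟩
  d ^ (4 * ((2 + j) * 2)) * d ^ 8  ≡⟨ ≡.sym (^-distribˡ-+-* d (4 * ((2 + j) * 2)) 8) ⟩
  d ^ (4 * ((2 + j) * 2) + 8)      ≤⟨ ^-monoʳ-≤ d (≤-trans (m≤m+n (4 * ((2 + j) * 2) + 8) (4 * j))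
                                                          (≤-reflexive (expand j))) ⟩
  d ^ (12 * (2 + j))               ∎
  where
  open ≤-Reasoning
  open +-*-Solver
  expand : ∀ j → 4 * ((2 + j) * 2) + 8 + 4 * j ≡ 12 * (2 + j)
  expand = solve 1 (λ j → con 4 :* ((con 2 :+ j) :* con 2) :+ con 8 :+ con 4 :* j := con 12 :* (con 2 :+ j)) refl

lemma2p4 : (d k : ℕ) → 2 ≤ d → 2 ≤ k → (n : ℕ) → d ^ (12 * k) ≤ n →
    (c : EdgeColoring n k) → ¬ HasRainbow d c → HasMonochromatic 4 c
lemma2p4 1 k (s≤s ()) 2≤k n large c no-rainbow
lemma2p4 2 k _ 2≤k n large c no-rainbow =
  contradiction (Coloring.rainbow-K₂ c (proj₂ (proj₂ (two-distinct 2≤n)))) no-rainbow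
  where
  2≤n : 2 ≤ n
  2≤n = ≤-trans (^-monoʳ-≤ 2 (≤-trans (s≤s z≤n) (≤-trans 2≤k (m≤n*m k 12)))) large
lemma2p4 d@(suc (suc (suc _))) k _ 2≤k n large c no-rainbow =
  Coloring.HubSearch.monochromatic-K₄ c d (s≤s (s≤s (s≤s z≤n))) no-rainbow
    (≤-trans (exponent-bound 2≤k) large)
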